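{- Let $Q$ be an abelian group of order $q$, let $\Gamma=H(n,q)$ with vertex set the group $Q^n$, and let $C$ be an additive completely regular code in $\Gamma$ with minimum distance $\delta(C)\ge2$. Suppose the quotient graph $\Gamma/\Delta(C)$ is isomorphic to the Hamming graph $H(m,q')$. Then $m$ divides $n$ and, up to a permutation of the coordinate positions, $C=\prod_{i=1}^m C^{(i)}$, where each $C^{(i)}$ is a $q$-ary completely regular code of length $n/m$ with covering radius $1$.
   Context: $H(n,q)$ has vertex set $Q^n$, two words adjacent iff they differ in exactly one coordinate. An additive code is a subgroup $C\le Q^n$; $\Delta(C)=\{C+x:x\in Q^n\}$ is its coset partition, and $\Gamma/\Delta(C)$ is the graph on the cosets, two distinct cosets adjacent iff some edge of $\Gamma$ joins them. $\delta(C)$ is the minimum Hamming distance between distinct codewords. For a code $C$, $C_i$ is the set of vertices at distance $i$ from $C$ and the covering radius $\rho$ is the largest $i$ with $C_i\neq\emptyset$; $C$ is completely regular if $\{C_0,\dots,C_\rho\}$ is an equitable partition (the number of neighbours in $C_j$ of a vertex of $C_i$ depends only on $i,j$). A $q$-ary code of length $\ell$ is a code in $H(\ell,q)$, and $\prod_i C^{(i)}$ denotes the cartesian product of codes, concatenating coordinates. -}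

module Defs where

open import Data.Nat using (ℕ; zero; suc; _+_; _⊓_; _≡ᵇ_)
open import Data.Nat.Properties using ()
open import Data.Bool using (Bool; true; false; if_then_else_; _∧_; not)
open import Data.Fin using (Fin)
open import Data.Fin.Properties using (_≟_)
open import Data.Vec using (Vec; []; _∷_; zipWith; map; replicate; lookup; _[_]≔_)
import Data.List as L
open import Data.List using (List)
open import Data.Nat.ListAction renaming (sum to sumL)
open import Data.Empty using (⊥)
open import Function.Bundles using (_⇔_)
open import Data.Product using (Σ; _×_; _,_; ∃)
open import Relation.Nullary using (does)
open import Relation.Binary.PropositionalEquality using (_≡_)
open import Algebra.Structures using (IsAbelianGroup)
open import Data.Nat using (_≤_)

-- A finite abelian group Q of order q, represented (up to isomorphism)
-- on the carrier Fin q with propositional equality.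

record AbelianGroupOn (q : ℕ) : Set where
  field
    _⊕_ : Fin q → Fin q → Fin q
    𝟘   : Fin q
    ⊖_  : Fin q → Fin q
    isAbelianGroup : IsAbelianGroup _≡_ _⊕_ 𝟘 ⊖_

Word : ℕ → ℕ → Set
Word n q = Vec (Fin q) n

Code : ℕ → ℕ → Set
Code n q = Word n q → Bool

_∈C_ : ∀ {n q} → Word n q → Code n q → Set
x ∈C C = C x ≡ true

ham : ∀ {n q} → Word n q → Word n q → ℕ
ham []       []       = 0
ham (a ∷ x) (b ∷ y) = (if does (a ≟ b) then 0 else 1) + ham x y

allWords : (n q : ℕ) → List (Word n q)
allWords zero    q = [] L.∷ L.[]
allWords (suc n) q = L.concatMap (λ a → L.map (a ∷_) (allWords n q)) (L.allFin q)

-- Distance from x to the code C: min over codewords y of ham x y.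
-- (For nonempty C this is the usual d(x,C); the default value suc n is
-- never attained by a nonempty code since ham x y ≤ n.)
distC : ∀ {n q} → Code n q → Word n q → ℕ
distC {n} {q} C x =
  L.foldr (λ y acc → if C y then ham x y ⊓ acc else acc) (suc n) (allWords n q)

nbrCount : ∀ {n q} → Code n q → Word n q → ℕ → ℕ
nbrCount {n} {q} C x j =
  sumL (L.map (λ k → sumL (L.map (λ a →
     if not (does (a ≟ lookup x k)) ∧ (distC C (x [ k ]≔ a) ≡ᵇ j) then 1 else 0)
     (L.allFin q))) (L.allFin n))

CoveringRadius : ∀ {n q} → Code n q → ℕ → Set
CoveringRadius {n} {q} C ρ =
  (∃ λ (y : Word n q) → y ∈C C) ×
  (∀ (x : Word n q) → distC C x ≤ ρ) ×
  (∃ λ (x : Word n q) → distC C x ≡ ρ)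

-- Completely regular: the distance partition {C_0,...,C_ρ} is equitable,
-- i.e. the number of neighbours in C_j of a vertex of C_i depends only on i,j.
CompletelyRegular : ∀ {n q} → Code n q → Set
CompletelyRegular {n} {q} C =
  (∃ λ (y : Word n q) → y ∈C C) ×
  (∀ (x y : Word n q) → distC C x ≡ distC C y →
     ∀ (j : ℕ) → nbrCount C x j ≡ nbrCount C y j)

module WordGroup {q : ℕ} (G : AbelianGroupOn q) where
  open AbelianGroupOn G

  _+w_ : ∀ {n} → Word n q → Word n q → Word n q
  _+w_ = zipWith _⊕_

  -w_ : ∀ {n} → Word n q → Word n q
  -w_ = map ⊖_

  0w : ∀ {n} → Word n q
  0w = replicate _ 𝟘

  _-w_ : ∀ {n} → Word n q → Word n q → Word n q
  x -w y = x +w (-w y)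

  Additive : ∀ {n} → Code n q → Set
  Additive C = (0w ∈C C) ×
               (∀ x y → x ∈C C → y ∈C C → (x +w y) ∈C C) ×
               (∀ x → x ∈C C → (-w x) ∈C C)

  -- The quotient graph Γ/Δ(C) (vertices: cosets C + x; distinct cosets
  -- adjacent iff some edge of H(n,q) joins them) is isomorphic to H(m,q').
  -- Encoded by a map φ : Q^n → Q'^m whose fibres are exactly the cosets of C
  -- (so φ induces a bijection Δ(C) → Q'^m, being surjective) and which
  -- transports adjacency of distinct cosets to adjacency in H(m,q').
  QuotientIsoHamming : ∀ {n} → Code n q → (m q' : ℕ) → Set
  QuotientIsoHamming {n} C m q' =
    Σ (Word n q → Word m q') λ φ →
      (∀ x y → (φ x ≡ φ y) ⇔ ((x -w y) ∈C C)) ×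
      (∀ (z : Word m q') → ∃ λ x → φ x ≡ z) ×
      (∀ x y → (φ x ≡ φ y → ⊥) →
         (Σ (Word n q) (λ x' → Σ (Word n q) λ y' →
             φ x' ≡ φ x × φ y' ≡ φ y × ham x' y' ≡ 1))
         ⇔ (ham (φ x) (φ y) ≡ 1))

MinDistAtLeast2 : ∀ {n q} → Code n q → Set
MinDistAtLeast2 C = ∀ x y → x ∈C C → y ∈C C → (x ≡ y → ⊥) → 2 ≤ ham x y

module Submission where

-- Let φ : Q^n → Q'^m be the quotient map realising Γ/Δ(C) ≅ H(m,q'): its fibres
-- are the cosets of C and it sends edges of H(n,q) between distinct cosets to
-- edges of H(m,q').
-- 1. Because δ(C) ≥ 2, moving x to x + a·e_k (a ≠ 0) changes the coset, so φ
--    moves along a single coordinate of H(m,q').  In a Hamming graph triangles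
--    lie on a line and 4-cycles are rectangles; with these facts an induction
--    over words shows that this coordinate d(k) depends neither on x nor on a.
-- 2. Consequently φ(x)_i depends only on the block d⁻¹(i) of coordinates of x,
--    and d(x,C) = 1 exactly when φ(x) is adjacent to φ(0).
-- 3. A word x with φ(x) adjacent to φ(0) in coordinate i has exactly
--    |d⁻¹(i)|·(q-1) neighbours at distance ≤ 1 from C.  Complete regularity
--    makes this independent of i: all blocks have one size ℓ and n = mℓ.
-- 4. Restricting C to block i gives a code C⁽ⁱ⁾ of length ℓ; C is their
--    product, non-codewords of C⁽ⁱ⁾ are at distance 1, and the neighbour counts
--    of C⁽ⁱ⁾ are those of C, so C⁽ⁱ⁾ is completely regular of covering radius 1.
-- The file first develops, in general form, Hamming-graph geometry, finite
-- sums, distances to a code, codes of covering radius 1, partitions into equal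
-- blocks and word arithmetic; the module `Geometry` carries out steps 1-3,
-- `Decomposition` step 4, and theorem3p11 assembles the pieces.

open import Defs
open import Data.Nat using (ℕ; zero; suc; _≤_; _*_; _+_; _∸_; _⊓_; z≤n; s≤s; _≡ᵇ_)
import Data.Nat.Properties as ℕP
open import Data.Nat.Divisibility using (_∣_; m∣m*n)
open import Data.Nat.ListAction using (sum)
open import Data.Fin using (Fin; zero; suc; cast)
open import Data.Fin.Properties using (_≟_)
import Data.Fin.Properties as FinP
open import Data.Vec using (Vec; []; _∷_; tabulate; lookup; _[_]≔_)
open import Data.Vec.Properties
  using (tabulate∘lookup; tabulate-cong; lookup∘update; lookup∘update′; lookup∘tabulate; lookup-replicate; ≡-dec)
import Data.List as L
open import Data.List using (List)
import Data.List.Properties as ListP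
open import Data.List.Membership.Propositional using (_∈_)
open import Data.List.Membership.Propositional.Properties
  using (∈-concat⁺′; ∈-map⁺; ∈-allFin; ∈-filter⁺; ∈-filter⁻; ∈-lookup)
open import Data.List.Relation.Unary.Any using (here; there; index)
open import Data.List.Relation.Unary.Any.Properties using (lookup-index)
import Data.List.Relation.Unary.All as All
open import Data.List.Relation.Unary.AllPairs using (_∷_)
open import Data.List.Relation.Unary.Unique.Propositional using (Unique)
open import Data.List.Relation.Unary.Unique.Propositional.Properties using (allFin⁺; filter⁺)
open import Data.Product using (Σ; _×_; _,_; ∃; proj₁; proj₂)
open import Data.Sum using (_⊎_; inj₁; inj₂)
import Data.Sum as Sum
open import Data.Empty using (⊥; ⊥-elim)
open import Data.Unit using (⊤; tt)
open import Data.Bool using (Bool; true; false; if_then_else_; _∧_; not)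
import Data.Bool.Properties
open import Function.Bundles using (_⇔_; _↔_; Inverse; Equivalence; mk⇔; mk↔ₛ′)
open import Relation.Nullary using (¬_; Dec; yes; no; does; ¬?)
open import Relation.Unary using (Pred; Decidable)
open import Relation.Binary.PropositionalEquality
  using (_≡_; _≢_; refl; sym; trans; cong; cong₂; subst; subst₂; isEquivalence; module ≡-Reasoning)
open import Level using (0ℓ)
open import Algebra.Bundles using (AbelianGroup)
open import Algebra.Structures using (IsAbelianGroup)
import Algebra.Properties.AbelianGroup as AbelianGroupProperties
import Algebra.Properties.CommutativeSemigroup as CommutativeSemigroupProperties

vext : ∀ {a} {A : Set a} {n} {xs ys : Vec A n} → (∀ i → lookup xs i ≡ lookup ys i) → xs ≡ ys
vext {xs = xs} {ys} p = trans (sym (tabulate∘lookup xs)) (trans (tabulate-cong p) (tabulate∘lookup ys))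

module _ {a} {A : Set a} {m : ℕ} where

  record DiffAt (x y : Vec A m) (i : Fin m) : Set a where
    constructor diffAt
    field
      differs : lookup x i ≢ lookup y i
      agrees  : ∀ j → j ≢ i → lookup x j ≡ lookup y j
  open DiffAt public

  private
    variable
      x y z p₀ p₁ p₂ p₃ : Vec A m
      i j r α β γ δ : Fin m

  DiffAt-sym : DiffAt x y i → DiffAt y x i
  DiffAt-sym (diffAt ne eq) = diffAt (λ e → ne (sym e)) (λ j j≢i → sym (eq j j≢i))

  DiffAt-only : DiffAt x y r → lookup x i ≢ lookup y i → i ≡ r
  DiffAt-only {r = r} {i = i} (diffAt _ eq) ne with i ≟ r
  ... | yes i≡r = i≡r
  ... | no i≢r = ⊥-elim (ne (eq i i≢r))

  DiffAt-unique : DiffAt x y i → DiffAt x y j → i ≡ j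
  DiffAt-unique dᵢ dⱼ = DiffAt-only dⱼ (differs dᵢ)

  DiffAt⇒≢ : DiffAt x y i → x ≢ y
  DiffAt⇒≢ (diffAt ne _) refl = ne refl

  DiffAt⇒update : DiffAt x y i → y ≡ x [ i ]≔ lookup y i
  DiffAt⇒update {x = x} {y = y} {i = i} dxy = vext pointwise
    where
    pointwise : ∀ j → lookup y j ≡ lookup (x [ i ]≔ lookup y i) j
    pointwise j with j ≟ i
    ... | yes refl = sym (lookup∘update i x (lookup y i))
    ... | no j≢i = trans (sym (agrees dxy j j≢i)) (sym (lookup∘update′ j≢i x (lookup y i)))

  DiffAt-update : ∀ (x : Vec A m) k c → c ≢ lookup x k → DiffAt x (x [ k ]≔ c) k
  DiffAt-update x k c c≢ =
    diffAt (λ e → c≢ (trans (sym (lookup∘update k x c)) (sym e)))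
           (λ j j≢k → sym (lookup∘update′ j≢k x c))

  triangle : DiffAt x y i → DiffAt x z j → DiffAt y z r → i ≡ j
  triangle {x = x} {y = y} {i = i} {z = z} {j = j} dxy dxz dyz with i ≟ j
  ... | yes i≡j = i≡j
  ... | no i≢j = ⊥-elim (i≢j (trans (DiffAt-only dyz ne-i) (sym (DiffAt-only dyz ne-j))))
    where
    ne-i : lookup y i ≢ lookup z i
    ne-i e = differs dxy (trans (agrees dxz i i≢j) (sym e))
    ne-j : lookup y j ≢ lookup z j
    ne-j e = differs dxz (trans (agrees dxy j (λ e′ → i≢j (sym e′))) e)

  triangle′ : DiffAt x y i → DiffAt x z j → DiffAt y z r → r ≡ i
  triangle′ dxy dxz dyz = sym (triangle (DiffAt-sym dxy) dyz dxz)

  rectangle : DiffAt p₀ p₁ α → DiffAt p₀ p₂ β → α ≢ β → DiffAt p₁ p₃ γ → DiffAt p₂ p₃ δ →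
              p₃ ≢ p₀ → γ ≡ β
  rectangle {p₀ = p₀} {p₁ = p₁} {α = α} {p₂ = p₂} {β = β} {p₃ = p₃} {γ = γ} {δ = δ}
            d₀₁ d₀₂ α≢β d₁₃ d₂₃ p₃≢p₀ with γ ≟ β
  ... | yes γ≡β = γ≡β
  ... | no γ≢β = ⊥-elim (p₃≢p₀ (vext p₃≗p₀))
    where
    p₃≡p₀-at-β : lookup p₃ β ≡ lookup p₀ β
    p₃≡p₀-at-β = trans (sym (agrees d₁₃ β (λ e → γ≢β (sym e)))) (sym (agrees d₀₁ β (λ e → α≢β (sym e))))
    β≡δ : β ≡ δ
    β≡δ = DiffAt-only d₂₃ (λ e → differs d₀₂ (trans (sym p₃≡p₀-at-β) (sym e)))
    p₃≗p₀ : ∀ j → lookup p₃ j ≡ lookup p₀ j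
    p₃≗p₀ j with j ≟ β
    ... | yes refl = p₃≡p₀-at-β
    ... | no j≢β = trans (sym (agrees d₂₃ j (λ e → j≢β (trans e (sym β≡δ))))) (sym (agrees d₀₂ j j≢β))

  line : DiffAt p₀ p₁ α → DiffAt p₀ p₂ α → p₁ ≢ p₂ → DiffAt p₁ p₃ γ → DiffAt p₂ p₃ δ → γ ≡ α
  line {p₀ = p₀} {p₁ = p₁} {α = α} {p₂ = p₂} {p₃ = p₃} {γ = γ} {δ = δ} d₀₁ d₀₂ p₁≢p₂ d₁₃ d₂₃
    with γ ≟ α
  ... | yes γ≡α = γ≡α
  ... | no γ≢α = ⊥-elim (γ≢α (trans γ≡δ (sym α≡δ)))
    where
    p₁≢p₂-at-α : lookup p₁ α ≢ lookup p₂ α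
    p₁≢p₂-at-α e = p₁≢p₂ (vext p₁≗p₂)
      where
      p₁≗p₂ : ∀ j → lookup p₁ j ≡ lookup p₂ j
      p₁≗p₂ j with j ≟ α
      ... | yes refl = e
      ... | no j≢α = trans (sym (agrees d₀₁ j j≢α)) (agrees d₀₂ j j≢α)
    p₃≡p₁-at-α : lookup p₃ α ≡ lookup p₁ α
    p₃≡p₁-at-α = sym (agrees d₁₃ α (λ e → γ≢α (sym e)))
    α≡δ : α ≡ δ
    α≡δ = DiffAt-only d₂₃ (λ e → p₁≢p₂-at-α (trans (sym p₃≡p₁-at-α) (sym e)))
    γ≡δ : γ ≡ δ
    γ≡δ = DiffAt-only d₂₃ (λ e → differs d₁₃ (trans (trans (sym (agrees d₀₁ γ γ≢α)) (agrees d₀₂ γ γ≢α)) e))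

agree-off⇒DiffAt : ∀ {q m} (v z : Vec (Fin q) m) i → (∀ j → j ≢ i → lookup v j ≡ lookup z j) →
                   (v ≡ z) ⊎ DiffAt z v i
agree-off⇒DiffAt v z i agree with lookup v i ≟ lookup z i
... | yes same-at-i = inj₁ (vext v≗z)
  where
  v≗z : ∀ j → lookup v j ≡ lookup z j
  v≗z j with j ≟ i
  ... | yes refl = same-at-i
  ... | no j≢i = agree j j≢i
... | no differ-at-i = inj₂ (diffAt (λ e → differ-at-i (sym e)) (λ j j≢i → sym (agree j j≢i)))

module _ {q : ℕ} where

  ham-refl : ∀ {n} (x : Word n q) → ham x x ≡ 0
  ham-refl [] = refl
  ham-refl (a ∷ x) with a ≟ a
  ... | yes _ = ham-refl x
  ... | no a≢a = ⊥-elim (a≢a refl)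

  ham≡0⇒≡ : ∀ {n} {x y : Word n q} → ham x y ≡ 0 → x ≡ y
  ham≡0⇒≡ {x = []} {[]} _ = refl
  ham≡0⇒≡ {x = a ∷ x} {b ∷ y} h with a ≟ b
  ... | yes a≡b = cong₂ _∷_ a≡b (ham≡0⇒≡ h)
  ... | no _ = ⊥-elim (ℕP.0≢1+n (sym h))

  ham≡1⇒DiffAt : ∀ {n} {x y : Word n q} → ham x y ≡ 1 → ∃ λ i → DiffAt x y i
  ham≡1⇒DiffAt {x = []} {[]} ()
  ham≡1⇒DiffAt {x = a ∷ x} {b ∷ y} h with a ≟ b
  ... | yes a≡b with ham≡1⇒DiffAt {x = x} {y} h
  ...   | i , diffAt ne eq =
    suc i , diffAt ne λ { zero _ → a≡b ; (suc j) j≢ → eq j (λ e → j≢ (cong suc e)) }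
  ham≡1⇒DiffAt {x = a ∷ x} {b ∷ y} h | no a≢b =
    zero , diffAt a≢b λ { zero 0≢0 → ⊥-elim (0≢0 refl)
                        ; (suc j) _ → cong (λ v → lookup v j) (ham≡0⇒≡ {x = x} {y} (ℕP.suc-injective h)) }

  DiffAt⇒ham≡1 : ∀ {n} {x y : Word n q} {i} → DiffAt x y i → ham x y ≡ 1
  DiffAt⇒ham≡1 {x = a ∷ x} {b ∷ y} {zero} (diffAt ne eq) with a ≟ b
  ... | yes a≡b = ⊥-elim (ne a≡b)
  ... | no _ = cong suc (trans (cong (ham x) (sym (vext (λ j → eq (suc j) (λ ()))))) (ham-refl x))
  DiffAt⇒ham≡1 {x = a ∷ x} {b ∷ y} {suc i} (diffAt ne eq) with a ≟ b
  ... | yes _ = DiffAt⇒ham≡1 {x = x} {y} {i} (diffAt ne λ j j≢ → eq (suc j) (λ e → j≢ (FinP.suc-injective e)))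
  ... | no a≢b = ⊥-elim (a≢b (eq zero (λ ())))

  ham≤length : ∀ {n} (x y : Word n q) → ham x y ≤ n
  ham≤length [] [] = z≤n
  ham≤length (a ∷ x) (b ∷ y) with a ≟ b
  ... | yes _ = ℕP.m≤n⇒m≤1+n (ham≤length x y)
  ... | no _ = s≤s (ham≤length x y)

  ham≡1⇒≢ : ∀ {n} {u v : Word n q} → ham u v ≡ 1 → u ≢ v
  ham≡1⇒≢ {u = u} h refl = ℕP.0≢1+n (trans (sym (ham-refl u)) h)

-- Finite sums of natural numbers over lists and over Fin n, in the shape used
-- by `nbrCount`: `sumFin n f` is definitionally the sum appearing there.
sumOver : ∀ {a} {A : Set a} → List A → (A → ℕ) → ℕ
sumOver xs f = sum (L.map f xs)

sumFin : (n : ℕ) → (Fin n → ℕ) → ℕ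
sumFin n f = sumOver (L.allFin n) f

sumOver-zero : ∀ {a} {A : Set a} (xs : List A) → sumOver xs (λ _ → 0) ≡ 0
sumOver-zero L.[] = refl
sumOver-zero (x L.∷ xs) = sumOver-zero xs

sumOver-+ : ∀ {a} {A : Set a} (xs : List A) (f g : A → ℕ) →
            sumOver xs (λ x → f x + g x) ≡ sumOver xs f + sumOver xs g
sumOver-+ L.[] f g = refl
sumOver-+ (x L.∷ xs) f g = trans (cong (f x + g x +_) (sumOver-+ xs f g))
  (interchange (f x) (g x) (sumOver xs f) (sumOver xs g))
  where open CommutativeSemigroupProperties ℕP.+-commutativeSemigroup using (interchange)

module _ {a} {A : Set a} where

  sumOver-cong : ∀ (xs : List A) {f g : A → ℕ} → (∀ x → f x ≡ g x) → sumOver xs f ≡ sumOver xs g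
  sumOver-cong xs f≗g = cong sum (ListP.map-cong f≗g xs)

  sumOver-*ʳ : ∀ (xs : List A) (f : A → ℕ) c → sumOver xs (λ x → f x * c) ≡ sumOver xs f * c
  sumOver-*ʳ L.[] f c = refl
  sumOver-*ʳ (x L.∷ xs) f c =
    trans (cong (f x * c +_) (sumOver-*ʳ xs f c)) (sym (ℕP.*-distribʳ-+ c (f x) (sumOver xs f)))

  sumOver-swap : ∀ {b} {B : Set b} (xs : List A) (ys : List B) (f : A → B → ℕ) →
                 sumOver xs (λ x → sumOver ys (f x)) ≡ sumOver ys (λ y → sumOver xs (λ x → f x y))
  sumOver-swap L.[] ys f = sym (sumOver-zero ys)
  sumOver-swap (x L.∷ xs) ys f = trans (cong (sumOver ys (f x) +_) (sumOver-swap xs ys f))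
    (sym (sumOver-+ ys (f x) (λ y → sumOver xs (λ x → f x y))))

  module _ {p} {P : Pred A p} (P? : Decidable P) where

    length-filter : ∀ xs → L.length (L.filter P? xs) ≡ sumOver xs (λ x → if does (P? x) then 1 else 0)
    length-filter L.[] = refl
    length-filter (x L.∷ xs) with P? x
    ... | yes _ = cong suc (length-filter xs)
    ... | no _ = length-filter xs

    sumOver-filter : ∀ xs (g : A → ℕ) → (∀ x → ¬ P x → g x ≡ 0) → sumOver xs g ≡ sumOver (L.filter P? xs) g
    sumOver-filter L.[] g vanish = refl
    sumOver-filter (x L.∷ xs) g vanish with P? x
    ... | yes _ = cong (g x +_) (sumOver-filter xs g vanish)
    ... | no ¬Px = trans (cong (_+ sumOver xs g) (vanish x ¬Px)) (sumOver-filter xs g vanish)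

  sumOver-lookup : ∀ (xs : List A) (g : A → ℕ) → sumOver xs g ≡ sumFin (L.length xs) (λ j → g (L.lookup xs j))
  sumOver-lookup xs g = begin
    sumOver xs g                                          ≡⟨ cong (λ ys → sumOver ys g) (sym (ListP.tabulate-lookup xs)) ⟩
    sum (L.map g (L.tabulate (L.lookup xs)))              ≡⟨ cong sum (ListP.map-tabulate (L.lookup xs) g) ⟩
    sum (L.tabulate (λ j → g (L.lookup xs j)))            ≡⟨ cong sum (sym (ListP.map-tabulate {n = L.length xs} (λ j → j) (λ j → g (L.lookup xs j)))) ⟩
    sumFin (L.length xs) (λ j → g (L.lookup xs j))        ∎
    where open ≡-Reasoning

sumFin-suc : ∀ n (f : Fin (suc n) → ℕ) → sumFin (suc n) f ≡ f zero + sumFin n (λ i → f (suc i))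
sumFin-suc n f = cong (f zero +_) (cong sum (trans (ListP.map-tabulate suc f) (sym (ListP.map-tabulate (λ i → i) (λ i → f (suc i))))))

sumFin-cong : ∀ n {f g : Fin n → ℕ} → (∀ i → f i ≡ g i) → sumFin n f ≡ sumFin n g
sumFin-cong n = sumOver-cong (L.allFin n)

sumFin-const : ∀ n c → sumFin n (λ _ → c) ≡ n * c
sumFin-const zero c = refl
sumFin-const (suc n) c = trans (sumFin-suc n (λ _ → c)) (cong (c +_) (sumFin-const n c))

sumFin-single : ∀ n (f : Fin n → ℕ) i → (∀ j → j ≢ i → f j ≡ 0) → sumFin n f ≡ f i
sumFin-single (suc n) f zero vanish = begin
  sumFin (suc n) f                        ≡⟨ sumFin-suc n f ⟩
  f zero + sumFin n (λ j → f (suc j))     ≡⟨ cong (f zero +_) (sumFin-cong n (λ j → vanish (suc j) (λ ()))) ⟩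
  f zero + sumFin n (λ _ → 0)             ≡⟨ cong (f zero +_) (sumOver-zero (L.allFin n)) ⟩
  f zero + 0                              ≡⟨ ℕP.+-identityʳ (f zero) ⟩
  f zero                                  ∎
  where open ≡-Reasoning
sumFin-single (suc n) f (suc i) vanish = begin
  sumFin (suc n) f                        ≡⟨ sumFin-suc n f ⟩
  f zero + sumFin n (λ j → f (suc j))     ≡⟨ cong (_+ sumFin n (λ j → f (suc j))) (vanish zero (λ ())) ⟩
  sumFin n (λ j → f (suc j))              ≡⟨ sumFin-single n (λ j → f (suc j)) i (λ j j≢i → vanish (suc j) (λ e → j≢i (FinP.suc-injective e))) ⟩
  f (suc i)                               ∎
  where open ≡-Reasoning

sumFin-cast : ∀ {a b} (e : b ≡ a) (h : Fin a → ℕ) → sumFin b (λ j → h (cast e j)) ≡ sumFin a h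
sumFin-cast {a} refl h = sumFin-cong a (λ j → cong h (FinP.cast-is-id refl j))

eqInd : ∀ {m} → Fin m → Fin m → ℕ
eqInd a b = if does (a ≟ b) then 1 else 0

neqInd : ∀ {m} → Fin m → Fin m → ℕ
neqInd a b = if not (does (a ≟ b)) then 1 else 0

eqInd-sym : ∀ {m} (a b : Fin m) → eqInd a b ≡ eqInd b a
eqInd-sym a b with a ≟ b | b ≟ a
... | yes _ | yes _ = refl
... | no _ | no _ = refl
... | yes a≡b | no b≢a = ⊥-elim (b≢a (sym a≡b))
... | no a≢b | yes b≡a = ⊥-elim (a≢b (sym b≡a))

sumFin-eqInd : ∀ n (b : Fin n) → sumFin n (λ a → eqInd a b) ≡ 1
sumFin-eqInd n b = trans (sumFin-single n _ b off) on
  where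
  off : ∀ j → j ≢ b → eqInd j b ≡ 0
  off j j≢b with j ≟ b
  ... | yes j≡b = ⊥-elim (j≢b j≡b)
  ... | no _ = refl
  on : eqInd b b ≡ 1
  on with b ≟ b
  ... | yes _ = refl
  ... | no b≢b = ⊥-elim (b≢b refl)

sumFin-neqInd : ∀ n (b : Fin n) → sumFin n (λ a → neqInd a b) ≡ n ∸ 1
sumFin-neqInd n b = begin
  sumFin n (λ a → neqInd a b)                                  ≡⟨ sym (ℕP.m+n∸n≡m _ 1) ⟩
  sumFin n (λ a → neqInd a b) + 1 ∸ 1                          ≡⟨ cong (λ t → sumFin n (λ a → neqInd a b) + t ∸ 1) (sym (sumFin-eqInd n b)) ⟩
  sumFin n (λ a → neqInd a b) + sumFin n (λ a → eqInd a b) ∸ 1  ≡⟨ cong (_∸ 1) (sym (sumOver-+ (L.allFin n) _ _)) ⟩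
  sumFin n (λ a → neqInd a b + eqInd a b) ∸ 1                  ≡⟨ cong (_∸ 1) (sumFin-cong n complementary) ⟩
  sumFin n (λ _ → 1) ∸ 1                                       ≡⟨ cong (_∸ 1) (trans (sumFin-const n 1) (ℕP.*-identityʳ n)) ⟩
  n ∸ 1                                                        ∎
  where
  open ≡-Reasoning
  complementary : ∀ a → neqInd a b + eqInd a b ≡ 1
  complementary a with a ≟ b
  ... | yes _ = refl
  ... | no _ = refl

allWords-complete : ∀ {n q} (w : Word n q) → w ∈ allWords n q
allWords-complete [] = here refl
allWords-complete {suc n} {q} (a ∷ w) =
  ∈-concat⁺′ (∈-map⁺ (a ∷_) (allWords-complete w)) (∈-map⁺ (λ b → L.map (b ∷_) (allWords n q)) (∈-allFin a))

true≢false : true ≢ false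
true≢false ()

if-yes : ∀ {p} {P : Set p} {A : Set} (P? : Dec P) {u v : A} → P → (if does P? then u else v) ≡ u
if-yes (yes _) _ = refl
if-yes (no ¬p) p = ⊥-elim (¬p p)

if-no : ∀ {p} {P : Set p} {A : Set} (P? : Dec P) {u v : A} → ¬ P → (if does P? then u else v) ≡ v
if-no (yes p) ¬p = ⊥-elim (¬p p)
if-no (no _) _ = refl

¬true⇒false : ∀ {b : Bool} → b ≢ true → b ≡ false
¬true⇒false {true} h = ⊥-elim (h refl)
¬true⇒false {false} _ = refl

module _ {n q : ℕ} (D : Code n q) (x : Word n q) where

  private
    minStep : Word n q → ℕ → ℕ
    minStep y acc = if D y then ham x y ⊓ acc else acc

    fold≤ : ∀ e (ys : List (Word n q)) {z} → z ∈ ys → D z ≡ true → L.foldr minStep e ys ≤ ham x z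
    fold≤ e (y L.∷ ys) (here refl) Dz rewrite Dz = ℕP.m⊓n≤m (ham x y) _
    fold≤ e (y L.∷ ys) (there z∈ys) Dz with D y
    ... | true = ℕP.≤-trans (ℕP.m⊓n≤n (ham x y) _) (fold≤ e ys z∈ys Dz)
    ... | false = fold≤ e ys z∈ys Dz

    fold-attained : ∀ e (ys : List (Word n q)) →
                    (L.foldr minStep e ys ≡ e) ⊎ (∃ λ z → (D z ≡ true) × (L.foldr minStep e ys ≡ ham x z))
    fold-attained e L.[] = inj₁ refl
    fold-attained e (y L.∷ ys) with D y in Dy
    ... | false = fold-attained e ys
    ... | true with ℕP.⊓-sel (ham x y) (L.foldr minStep e ys)
    ...   | inj₁ p = inj₂ (y , Dy , p)
    ...   | inj₂ p = Sum.map (trans p) (λ { (z , Dz , p′) → z , Dz , trans p p′ }) (fold-attained e ys)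

  distC≤ham : ∀ z → D z ≡ true → distC D x ≤ ham x z
  distC≤ham z Dz = fold≤ (suc n) (allWords n q) (allWords-complete z) Dz

  codeword⇒distC≡0 : D x ≡ true → distC D x ≡ 0
  codeword⇒distC≡0 Dx = ℕP.n≤0⇒n≡0 (ℕP.≤-trans (distC≤ham x Dx) (ℕP.≤-reflexive (ham-refl x)))

  distC-attained : ∀ y → D y ≡ true → ∃ λ z → (D z ≡ true) × (distC D x ≡ ham x z)
  distC-attained y Dy with fold-attained (suc n) (allWords n q)
  ... | inj₂ attained = attained
  ... | inj₁ default = ⊥-elim (ℕP.<-irrefl refl
          (ℕP.≤-trans (ℕP.≤-reflexive (sym default)) (ℕP.≤-trans (distC≤ham y Dy) (ham≤length x y))))

  distC≡0⇒codeword : distC D x ≡ 0 → D x ≡ true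
  distC≡0⇒codeword h with fold-attained (suc n) (allWords n q)
  ... | inj₁ default = ⊥-elim (ℕP.0≢1+n (trans (sym h) default))
  ... | inj₂ (z , Dz , e) = subst (λ w → D w ≡ true) (sym (ham≡0⇒≡ (trans (sym e) h))) Dz

  distC≡ᵇ0 : (distC D x ≡ᵇ 0) ≡ D x
  distC≡ᵇ0 with D x in Dx
  ... | true = cong (_≡ᵇ 0) (codeword⇒distC≡0 Dx)
  ... | false with distC D x in dx
  ...   | zero = ⊥-elim (true≢false (trans (sym (distC≡0⇒codeword dx)) Dx))
  ...   | suc _ = refl

  adjacent⇒distC≤1 : ∀ z → D z ≡ true → ham x z ≡ 1 → distC D x ≤ 1
  adjacent⇒distC≤1 z Dz h = ℕP.≤-trans (distC≤ham z Dz) (ℕP.≤-reflexive h)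

≤1∧≢0⇒≡1 : ∀ {x} → x ≤ 1 → x ≢ 0 → x ≡ 1
≤1∧≢0⇒≡1 {zero} _ x≢0 = ⊥-elim (x≢0 refl)
≤1∧≢0⇒≡1 {suc zero} _ _ = refl
≤1∧≢0⇒≡1 {suc (suc x)} (s≤s ()) _

-- Neighbour counts.  `countNeighbours x t` counts the neighbours of x in
-- H(n,q) passing the test t; `nbrCount C x j` is the instance
-- t y = (distC C y ≡ᵇ j), by definition.
indicator : Bool → ℕ
indicator b = if b then 1 else 0

countNeighbours : ∀ {n q} → Word n q → (Word n q → Bool) → ℕ
countNeighbours {n} {q} x t =
  sumFin n (λ k → sumFin q (λ a → indicator (not (does (a ≟ lookup x k)) ∧ t (x [ k ]≔ a))))

letter-count-cong : ∀ {q} (c : Fin q) {t t′ : Fin q → Bool} → (∀ a → a ≢ c → t a ≡ t′ a) →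
  sumFin q (λ a → indicator (not (does (a ≟ c)) ∧ t a)) ≡ sumFin q (λ a → indicator (not (does (a ≟ c)) ∧ t′ a))
letter-count-cong {q} c same = sumFin-cong q λ a → guarded (a ≟ c) (same a)
  where
  guarded : ∀ {a} (a≟c : Dec (a ≡ c)) {b b′} → (a ≢ c → b ≡ b′) →
            indicator (not (does a≟c) ∧ b) ≡ indicator (not (does a≟c) ∧ b′)
  guarded (yes _) _ = refl
  guarded (no a≢c) b≡b′ = cong indicator (b≡b′ a≢c)

letter-count-const : ∀ {q} (c : Fin q) b →
  sumFin q (λ a → indicator (not (does (a ≟ c)) ∧ b)) ≡ (if b then q ∸ 1 else 0)
letter-count-const {q} c true =
  trans (sumFin-cong q (λ a → cong indicator (Data.Bool.Properties.∧-identityʳ _))) (sumFin-neqInd q c)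
letter-count-const {q} c false =
  trans (sumFin-cong q (λ a → cong indicator (Data.Bool.Properties.∧-zeroʳ _))) (sumOver-zero (L.allFin q))

countNeighbours-cong : ∀ {n q} (x : Word n q) {t t′ : Word n q → Bool} →
  (∀ k a → a ≢ lookup x k → t (x [ k ]≔ a) ≡ t′ (x [ k ]≔ a)) → countNeighbours x t ≡ countNeighbours x t′
countNeighbours-cong {n} x same = sumFin-cong n λ k → letter-count-cong (lookup x k) (same k)

countNeighbours-const : ∀ {n q} (x : Word n q) b →
                        countNeighbours x (λ _ → b) ≡ n * (if b then q ∸ 1 else 0)
countNeighbours-const {n} x b = trans (sumFin-cong n (λ k → letter-count-const (lookup x k) b)) (sumFin-const n _)

countNeighbours-complement : ∀ {n q} (x : Word n q) t →
  countNeighbours x t + countNeighbours x (λ y → not (t y)) ≡ n * (q ∸ 1)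
countNeighbours-complement {n} {q} x t = begin
  countNeighbours x t + countNeighbours x (λ y → not (t y))
    ≡⟨ sym (sumOver-+ (L.allFin n) _ _) ⟩
  sumFin n (λ k → sumFin q _ + sumFin q _)
    ≡⟨ sumFin-cong n (λ k → trans (sym (sumOver-+ (L.allFin q) _ _)) (sumFin-cong q (λ a → split (not (does (a ≟ lookup x k))) (t (x [ k ]≔ a))))) ⟩
  countNeighbours x (λ _ → true)
    ≡⟨ countNeighbours-const x true ⟩
  n * (q ∸ 1) ∎
  where
  open ≡-Reasoning
  split : ∀ c b → indicator (c ∧ b) + indicator (c ∧ not b) ≡ indicator (c ∧ true)
  split true true = refl
  split true false = refl
  split false _ = refl

-- Codes of covering radius at most 1, i.e. whose non-codewords are all at
-- distance 1: their neighbour counts only depend on codeword membership.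
module Radius1 {ℓ q : ℕ} (D : Code ℓ q) (nonempty : ∃ λ y → y ∈C D)
                 (non-codeword-at-1 : ∀ y → D y ≡ false → distC D y ≡ 1) where

  distIndicator : ℕ → Bool → Bool
  distIndicator zero b = b
  distIndicator (suc zero) b = not b
  distIndicator (suc (suc _)) _ = false

  distC≡ᵇ : ∀ y j → (distC D y ≡ᵇ j) ≡ distIndicator j (D y)
  distC≡ᵇ y j with D y in Dy
  ... | true = trans (cong (_≡ᵇ j) (codeword⇒distC≡0 D y Dy)) (at-0 j)
    where
    at-0 : ∀ j → (0 ≡ᵇ j) ≡ distIndicator j true
    at-0 zero = refl
    at-0 (suc zero) = refl
    at-0 (suc (suc _)) = refl
  ... | false = trans (cong (_≡ᵇ j) (non-codeword-at-1 y Dy)) (at-1 j)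
    where
    at-1 : ∀ j → (1 ≡ᵇ j) ≡ distIndicator j false
    at-1 zero = refl
    at-1 (suc zero) = refl
    at-1 (suc (suc _)) = refl

  nbrCount-by-membership : ∀ x j → nbrCount D x j ≡ countNeighbours x (λ y → distIndicator j (D y))
  nbrCount-by-membership x j =
    countNeighbours-cong x {t = λ y → distC D y ≡ᵇ j} {t′ = λ y → distIndicator j (D y)} (λ k a _ → distC≡ᵇ (x [ k ]≔ a) j)

  within-1 : ∀ y → distC D y ≤ 1
  within-1 y with D y in Dy
  ... | true = ℕP.≤-trans (ℕP.≤-reflexive (codeword⇒distC≡0 D y Dy)) z≤n
  ... | false = ℕP.≤-reflexive (non-codeword-at-1 y Dy)

  coveringRadius-1 : (∃ λ y → D y ≡ false) → CoveringRadius D 1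
  coveringRadius-1 (y , Dy) = nonempty , within-1 , (y , non-codeword-at-1 y Dy)

  completelyRegular :
    (∀ x k a → D x ≡ true → a ≢ lookup x k → D (x [ k ]≔ a) ≡ false) →
    (∀ x y → D x ≡ false → D y ≡ false → countNeighbours x D ≡ countNeighbours y D) →
    CompletelyRegular D
  completelyRegular isolated equal-codeword-neighbours = nonempty , regular
    where
    codeword-count : ∀ x j → D x ≡ true → nbrCount D x j ≡ ℓ * (if distIndicator j false then q ∸ 1 else 0)
    codeword-count x j Dx = begin
      nbrCount D x j                                         ≡⟨ nbrCount-by-membership x j ⟩
      countNeighbours x (λ y → distIndicator j (D y))        ≡⟨ countNeighbours-cong x {t = λ y → distIndicator j (D y)} {t′ = λ _ → distIndicator j false} (λ k a a≢ → cong (distIndicator j) (isolated x k a Dx a≢)) ⟩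
      countNeighbours x (λ _ → distIndicator j false)        ≡⟨ countNeighbours-const x _ ⟩
      ℓ * (if distIndicator j false then q ∸ 1 else 0)       ∎
      where open ≡-Reasoning

    non-codeword-count : ∀ x y j → D x ≡ false → D y ≡ false →
      countNeighbours x (λ w → distIndicator j (D w)) ≡ countNeighbours y (λ w → distIndicator j (D w))
    non-codeword-count x y zero Dx Dy = equal-codeword-neighbours x y Dx Dy
    non-codeword-count x y (suc zero) Dx Dy = ℕP.+-cancelˡ-≡ (countNeighbours x D) _ _ (begin
      countNeighbours x D + countNeighbours x (λ w → not (D w))   ≡⟨ countNeighbours-complement x D ⟩
      ℓ * (q ∸ 1)                                                 ≡⟨ sym (countNeighbours-complement y D) ⟩
      countNeighbours y D + countNeighbours y (λ w → not (D w))   ≡⟨ cong (_+ _) (sym (equal-codeword-neighbours x y Dx Dy)) ⟩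
      countNeighbours x D + countNeighbours y (λ w → not (D w))   ∎)
      where open ≡-Reasoning
    non-codeword-count x y (suc (suc j)) Dx Dy =
      trans (countNeighbours-const x false) (sym (countNeighbours-const y false))

    regular : ∀ x y → distC D x ≡ distC D y → ∀ j → nbrCount D x j ≡ nbrCount D y j
    regular x y same-dist j with D x in Dx | D y in Dy
    ... | true | true = trans (codeword-count x j Dx) (sym (codeword-count y j Dy))
    ... | true | false = ⊥-elim (ℕP.0≢1+n (trans (sym (codeword⇒distC≡0 D x Dx)) (trans same-dist (non-codeword-at-1 y Dy))))
    ... | false | true = ⊥-elim (ℕP.0≢1+n (trans (sym (codeword⇒distC≡0 D y Dy)) (trans (sym same-dist) (non-codeword-at-1 x Dx))))
    ... | false | false = begin
      nbrCount D x j                                   ≡⟨ nbrCount-by-membership x j ⟩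
      countNeighbours x (λ w → distIndicator j (D w))  ≡⟨ non-codeword-count x y j Dx Dy ⟩
      countNeighbours y (λ w → distIndicator j (D w))  ≡⟨ sym (nbrCount-by-membership y j) ⟩
      nbrCount D y j                                   ∎
      where open ≡-Reasoning

-- A map d : Fin n → Fin m all of whose fibres have ℓ elements identifies
-- Fin n with Fin m × Fin ℓ: the pair (i , j) is the j-th element of the fibre
-- over i.  In particular n = m·ℓ.
module EqualFibres (n m ℓ : ℕ) (d : Fin n → Fin m)
                   (fibre-size : ∀ i → sumFin n (λ k → eqInd (d k) i) ≡ ℓ) where

  fibre : Fin m → List (Fin n)
  fibre i = L.filter (λ k → d k ≟ i) (L.allFin n)

  length-fibre : ∀ i → L.length (fibre i) ≡ ℓ
  length-fibre i = trans (length-filter (λ k → d k ≟ i) (L.allFin n)) (fibre-size i)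

  private
    unique-fibre : ∀ i → Unique (fibre i)
    unique-fibre i = filter⁺ (λ k → d k ≟ i) (allFin⁺ n)

    ∈-fibre : ∀ k → k ∈ fibre (d k)
    ∈-fibre k = ∈-filter⁺ (λ k′ → d k′ ≟ d k) (∈-allFin k) refl

    index-unique : ∀ {a} {A : Set a} {xs : List A} {k : A} → Unique xs → (p : k ∈ xs) (j : Fin (L.length xs)) →
                   L.lookup xs j ≡ k → index p ≡ j
    index-unique (u ∷ us) (here e) zero h = refl
    index-unique (u ∷ us) (here e) (suc j) h = ⊥-elim (All.lookup u (∈-lookup j) (sym (trans h e)))
    index-unique (u ∷ us) (there p) zero h = ⊥-elim (All.lookup u p h)
    index-unique (u ∷ us) (there p) (suc j) h = cong suc (index-unique us p j h)

    cast-inverse : ∀ {a b} (e : a ≡ b) (x : Fin b) → cast e (cast (sym e) x) ≡ x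
    cast-inverse e x = trans (FinP.cast-trans (sym e) e x) (FinP.cast-is-id _ x)

  position : Fin m × Fin ℓ → Fin n
  position (i , j) = L.lookup (fibre i) (cast (sym (length-fibre i)) j)

  rank : Fin n → Fin ℓ
  rank k = cast (length-fibre (d k)) (index (∈-fibre k))

  d-position : ∀ i j → d (position (i , j)) ≡ i
  d-position i j = proj₂ (∈-filter⁻ (λ k → d k ≟ i) {xs = L.allFin n} (∈-lookup {xs = fibre i} (cast (sym (length-fibre i)) j)))

  position-rank : ∀ k → position (d k , rank k) ≡ k
  position-rank k = trans
    (cong (L.lookup (fibre (d k))) (trans (FinP.cast-trans (length-fibre (d k)) _ _) (FinP.cast-is-id _ _)))
    (sym (lookup-index (∈-fibre k)))

  position-rank′ : ∀ {i k} → d k ≡ i → position (i , rank k) ≡ k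
  position-rank′ refl = position-rank _

  rank-position : ∀ i j → rank (position (i , j)) ≡ j
  rank-position i j = trans (same-rank (d-position i j) (∈-fibre (position (i , j))) (cast (sym (length-fibre i)) j) refl)
                            (cast-inverse (length-fibre i) j)
    where
    same-rank : ∀ {k i′} (e : i′ ≡ i) (p : k ∈ fibre i′) (j₀ : Fin (L.length (fibre i))) → L.lookup (fibre i) j₀ ≡ k →
                cast (length-fibre i′) (index p) ≡ cast (length-fibre i) j₀
    same-rank refl p j₀ h = cong (cast (length-fibre _)) (index-unique (unique-fibre _) p j₀ h)

  π : (Fin m × Fin ℓ) ↔ Fin n
  π = mk↔ₛ′ position (λ k → d k , rank k) position-rank (λ (i , j) → cong₂ _,_ (d-position i j) (rank-position i j))

  sum-over-fibre : ∀ i (g : Fin n → ℕ) → (∀ k → d k ≢ i → g k ≡ 0) →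
                   sumFin n g ≡ sumFin ℓ (λ j → g (position (i , j)))
  sum-over-fibre i g vanish = begin
    sumFin n g                                              ≡⟨ sumOver-filter (λ k → d k ≟ i) (L.allFin n) g vanish ⟩
    sumOver (fibre i) g                                     ≡⟨ sumOver-lookup (fibre i) g ⟩
    sumFin (L.length (fibre i)) (λ j → g (L.lookup (fibre i) j)) ≡⟨ sym (sumFin-cast (sym (length-fibre i)) _) ⟩
    sumFin ℓ (λ j → g (position (i , j)))                   ∎
    where open ≡-Reasoning

  n≡m*ℓ : n ≡ m * ℓ
  n≡m*ℓ = begin
    n                                                        ≡⟨ sym (ℕP.*-identityʳ n) ⟩
    n * 1                                                    ≡⟨ sym (sumFin-const n 1) ⟩
    sumFin n (λ _ → 1)                                       ≡⟨ sumFin-cong n (λ k → sym (trans (sumFin-cong m (λ i → eqInd-sym (d k) i)) (sumFin-eqInd m (d k)))) ⟩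
    sumFin n (λ k → sumFin m (λ i → eqInd (d k) i))          ≡⟨ sumOver-swap (L.allFin n) (L.allFin m) (λ k i → eqInd (d k) i) ⟩
    sumFin m (λ i → sumFin n (λ k → eqInd (d k) i))          ≡⟨ sumFin-cong m fibre-size ⟩
    sumFin m (λ _ → ℓ)                                       ≡⟨ sumFin-const m ℓ ⟩
    m * ℓ                                                    ∎
    where open ≡-Reasoning

module AbelianGroupIdentities {c ℓ} (A : AbelianGroup c ℓ) where
  open AbelianGroup A renaming (sym to ≈-sym)
  open AbelianGroupProperties A using (⁻¹-∙-comm)
  open CommutativeSemigroupProperties commutativeSemigroup using (interchange)
  open import Relation.Binary.Reasoning.Setoid setoid

  translate-difference : ∀ x y z → (x ∙ z) - (y ∙ z) ≈ x - y
  translate-difference x y z = begin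
    (x ∙ z) ∙ (y ∙ z) ⁻¹      ≈⟨ ∙-congˡ (≈-sym (⁻¹-∙-comm y z)) ⟩
    (x ∙ z) ∙ (y ⁻¹ ∙ z ⁻¹)   ≈⟨ interchange x z (y ⁻¹) (z ⁻¹) ⟩
    (x ∙ y ⁻¹) ∙ (z ∙ z ⁻¹)   ≈⟨ ∙-congˡ (inverseʳ z) ⟩
    (x ∙ y ⁻¹) ∙ ε            ≈⟨ identityʳ _ ⟩
    x - y                     ∎

  add-difference : ∀ x y → x ∙ (y - x) ≈ y
  add-difference x y = begin
    x ∙ (y ∙ x ⁻¹)            ≈⟨ comm x _ ⟩
    (y ∙ x ⁻¹) ∙ x            ≈⟨ assoc y (x ⁻¹) x ⟩
    y ∙ (x ⁻¹ ∙ x)            ≈⟨ ∙-congˡ (inverseˡ x) ⟩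
    y ∙ ε                     ≈⟨ identityʳ y ⟩
    y                         ∎

letterGroup : ∀ {q} → AbelianGroupOn q → AbelianGroup 0ℓ 0ℓ
letterGroup {q} G = record { Carrier = Fin q ; _≈_ = _≡_ ; _∙_ = _⊕_ ; ε = 𝟘 ; _⁻¹ = ⊖_ ; isAbelianGroup = isAbelianGroup }
  where open AbelianGroupOn G

module Words {q : ℕ} (G : AbelianGroupOn q) where
  open AbelianGroupOn G
  open IsAbelianGroup isAbelianGroup using (assoc; comm; identityˡ; identityʳ; inverseˡ; inverseʳ)
  open WordGroup G public
  open AbelianGroupProperties (letterGroup G) public
    using (identityʳ-unique; x∙y⁻¹≈ε⇒x≈y; ε⁻¹≈ε; ⁻¹-injective)
  open AbelianGroupIdentities (letterGroup G) public using (add-difference)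

  +w-assoc : ∀ {n} (x y z : Word n q) → (x +w y) +w z ≡ x +w (y +w z)
  +w-assoc [] [] [] = refl
  +w-assoc (a ∷ x) (b ∷ y) (c ∷ z) = cong₂ _∷_ (assoc a b c) (+w-assoc x y z)

  +w-comm : ∀ {n} (x y : Word n q) → x +w y ≡ y +w x
  +w-comm [] [] = refl
  +w-comm (a ∷ x) (b ∷ y) = cong₂ _∷_ (comm a b) (+w-comm x y)

  +w-identityˡ : ∀ {n} (x : Word n q) → 0w +w x ≡ x
  +w-identityˡ [] = refl
  +w-identityˡ (a ∷ x) = cong₂ _∷_ (identityˡ a) (+w-identityˡ x)

  +w-inverseˡ : ∀ {n} (x : Word n q) → (-w x) +w x ≡ 0w
  +w-inverseˡ [] = refl
  +w-inverseˡ (a ∷ x) = cong₂ _∷_ (inverseˡ a) (+w-inverseˡ x)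

  isWordGroup : ∀ n → IsAbelianGroup _≡_ (_+w_ {n}) 0w (-w_)
  isWordGroup n = record
    { isGroup = record
      { isMonoid = record
        { isSemigroup = record
          { isMagma = record { isEquivalence = isEquivalence ; ∙-cong = cong₂ _+w_ }
          ; assoc = +w-assoc }
        ; identity = +w-identityˡ , λ x → trans (+w-comm x 0w) (+w-identityˡ x) }
      ; inverse = +w-inverseˡ , λ x → trans (+w-comm x (-w x)) (+w-inverseˡ x)
      ; ⁻¹-cong = cong (-w_) }
    ; comm = +w-comm }

  wordGroup : ℕ → AbelianGroup 0ℓ 0ℓ
  wordGroup n = record { isAbelianGroup = isWordGroup n }

  module WordIdentities {n : ℕ} = AbelianGroupIdentities (wordGroup n)
  open WordIdentities public using (translate-difference) renaming (add-difference to +w-difference)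
  module WordGroupProperties {n : ℕ} = AbelianGroupProperties (wordGroup n)
  open WordGroupProperties public using () renaming (xyx⁻¹≈y to translate-back)

  unit : ∀ {n} → Fin n → Fin q → Word n q
  unit k a = 0w [ k ]≔ a

  unit-zero : ∀ {n} (k : Fin n) → unit k 𝟘 ≡ 0w
  unit-zero zero = refl
  unit-zero (suc k) = cong (𝟘 ∷_) (unit-zero k)

  unit-+ : ∀ {n} (k : Fin n) a b → unit k a +w unit k b ≡ unit k (a ⊕ b)
  unit-+ {suc n} zero a b = cong ((a ⊕ b) ∷_) (+w-identityˡ 0w)
  unit-+ (suc k) a b = cong₂ _∷_ (identityˡ 𝟘) (unit-+ k a b)

  +w-unit : ∀ {n} (x : Word n q) k a → x +w unit k a ≡ x [ k ]≔ (lookup x k ⊕ a)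
  +w-unit (b ∷ x) zero a = cong ((b ⊕ a) ∷_) (trans (+w-comm x 0w) (+w-identityˡ x))
  +w-unit (b ∷ x) (suc k) a = cong₂ _∷_ (identityʳ b) (+w-unit x k a)

  -w-identityʳ : ∀ {n} (x : Word n q) → x -w 0w ≡ x
  -w-identityʳ x = trans (cong (x +w_) WordGroupProperties.ε⁻¹≈ε) (trans (+w-comm x 0w) (+w-identityˡ x))

  lookup--w : ∀ {n} (x y : Word n q) k → lookup (x -w y) k ≡ lookup x k ⊕ (⊖ lookup y k)
  lookup--w (a ∷ x) (b ∷ y) zero = refl
  lookup--w (a ∷ x) (b ∷ y) (suc k) = lookup--w x y k

  +w-unit-unit : ∀ {n} (w : Word n q) k a b → (w +w unit k a) +w unit k b ≡ w +w unit k (a ⊕ b)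
  +w-unit-unit w k a b = trans (+w-assoc w _ _) (cong (w +w_) (unit-+ k a b))

  +w-unit-zero : ∀ {n} (w : Word n q) k → w +w unit k 𝟘 ≡ w
  +w-unit-zero w k = trans (cong (w +w_) (unit-zero k)) (trans (+w-comm w 0w) (+w-identityˡ w))

  update-as-translate : ∀ {n} (x : Word n q) k c → x [ k ]≔ c ≡ x +w unit k (c ⊕ (⊖ lookup x k))
  update-as-translate x k c =
    sym (trans (+w-unit x k _) (cong (x [ k ]≔_) (add-difference (lookup x k) c)))

  DiffAt-unit : ∀ {n} (x : Word n q) k a → a ≢ 𝟘 → DiffAt x (x +w unit k a) k
  DiffAt-unit x k a a≢𝟘 = subst (λ y → DiffAt x y k) (sym (+w-unit x k a))
    (DiffAt-update x k _ (λ e → a≢𝟘 (identityʳ-unique (lookup x k) a e)))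

  DiffAt⇒unit : ∀ {n} {x y : Word n q} {k} → DiffAt x y k → Σ (Fin q) λ a → (a ≢ 𝟘) × (y ≡ x +w unit k a)
  DiffAt⇒unit {x = x} {y} {k} dxy =
    lookup y k ⊕ (⊖ lookup x k) ,
    (λ e → differs dxy (sym (x∙y⁻¹≈ε⇒x≈y _ _ e))) ,
    trans (DiffAt⇒update dxy) (update-as-translate x k (lookup y k))

  support-induction : ∀ {n} (R : Word n q → Set) (Allowed : Fin n → Set) → (∀ j → Dec (Allowed j)) →
    R 0w → (∀ w j b → Allowed j → R w → R (w +w unit j b)) →
    ∀ w → (∀ j → ¬ Allowed j → lookup w j ≡ 𝟘) → R w
  support-induction {zero} R Allowed allowed? R0 step [] _ = R0
  support-induction {suc n} R Allowed allowed? R0 step (a ∷ w) support = extend (allowed? zero)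
    where
    R-tail : Word n q → Set
    R-tail v = R (𝟘 ∷ v)
    step-tail : ∀ v j b → Allowed (suc j) → R-tail v → R-tail (v +w unit j b)
    step-tail v j b ok r = subst R (cong (_∷ (v +w unit j b)) (identityˡ 𝟘)) (step (𝟘 ∷ v) (suc j) b ok r)
    R-w : R-tail w
    R-w = support-induction R-tail (λ j → Allowed (suc j)) (λ j → allowed? (suc j)) R0 step-tail w
                            (λ j ¬ok → support (suc j) ¬ok)
    extend : Dec (Allowed zero) → R (a ∷ w)
    extend (yes ok) = subst R (cong₂ _∷_ (identityˡ a) (trans (+w-comm w 0w) (+w-identityˡ w))) (step (𝟘 ∷ w) zero a ok R-w)
    extend (no ¬ok) = subst (λ b → R (b ∷ w)) (sym (support zero ¬ok)) R-w

other-letter : ∀ {q} → 2 ≤ q → (z : Fin q) → Σ (Fin q) (λ a → a ≢ z)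
other-letter (s≤s (s≤s _)) zero = suc zero , λ ()
other-letter (s≤s (s≤s _)) (suc z) = zero , λ ()

-- Steps 1-3.  φ is the quotient map of Γ/Δ(C) ≅ H(m,q'); d k is the coordinate
-- of H(m,q') along which φ moves when a word moves along coordinate k.
module Geometry {q : ℕ} (G : AbelianGroupOn q) (q≥2 : 2 ≤ q) {n : ℕ} (C : Code n q)
  (0∈C : WordGroup.0w G ∈C C) (δ≥2 : MinDistAtLeast2 C)
  {m q' : ℕ} (iso : WordGroup.QuotientIsoHamming G C m q') where

  open AbelianGroupOn G
  open IsAbelianGroup isAbelianGroup using (inverseʳ)
  open Words G

  W : Set
  W = Word n q

  φ : W → Word m q'
  φ = proj₁ iso

  φ-fibres : ∀ x y → (φ x ≡ φ y) ⇔ ((x -w y) ∈C C)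
  φ-fibres = proj₁ (proj₂ iso)

  φ-onto : ∀ z → ∃ λ x → φ x ≡ z
  φ-onto = proj₁ (proj₂ (proj₂ iso))

  φ-edges : ∀ x y → φ x ≢ φ y →
            (Σ W λ x′ → Σ W λ y′ → φ x′ ≡ φ x × φ y′ ≡ φ y × ham x′ y′ ≡ 1) ⇔ (ham (φ x) (φ y) ≡ 1)
  φ-edges = proj₂ (proj₂ (proj₂ iso))

  origin : Word m q'
  origin = φ 0w

  φ≡⇒∈C : ∀ {x y} → φ x ≡ φ y → (x -w y) ∈C C
  φ≡⇒∈C {x} {y} = Equivalence.to (φ-fibres x y)

  ∈C⇒φ≡ : ∀ {x y} → (x -w y) ∈C C → φ x ≡ φ y
  ∈C⇒φ≡ {x} {y} = Equivalence.from (φ-fibres x y)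

  codeword⇒origin : ∀ {x} → x ∈C C → φ x ≡ origin
  codeword⇒origin {x} x∈C = ∈C⇒φ≡ (subst (_∈C C) (sym (-w-identityʳ x)) x∈C)

  origin⇒codeword : ∀ {x} → φ x ≡ origin → x ∈C C
  origin⇒codeword {x} h = subst (_∈C C) (-w-identityʳ x) (φ≡⇒∈C h)

  φ-translate : ∀ {u v} z → φ u ≡ φ v → φ (u +w z) ≡ φ (v +w z)
  φ-translate {u} {v} z h = ∈C⇒φ≡ (subst (_∈C C) (sym (translate-difference u v z)) (φ≡⇒∈C h))

  unit∉C : ∀ k a → a ≢ 𝟘 → ¬ (unit k a ∈C C)
  unit∉C k a a≢𝟘 unit∈C = ℕP.<-irrefl refl (ℕP.≤-trans
    (δ≥2 (unit k a) 0w unit∈C 0∈C (DiffAt⇒≢ (DiffAt-sym edge)))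
    (ℕP.≤-reflexive (DiffAt⇒ham≡1 (DiffAt-sym edge))))
    where
    edge : DiffAt 0w (unit k a) k
    edge = subst (λ y → DiffAt 0w y k) (+w-identityˡ (unit k a)) (DiffAt-unit 0w k a a≢𝟘)

  φ-moves : ∀ x k a → a ≢ 𝟘 → φ x ≢ φ (x +w unit k a)
  φ-moves x k a a≢𝟘 h = unit∉C k a a≢𝟘 (subst (_∈C C) (translate-back x (unit k a)) (φ≡⇒∈C (sym h)))

  φ-edge : ∀ x k a → a ≢ 𝟘 → ∃ λ r → DiffAt (φ x) (φ (x +w unit k a)) r
  φ-edge x k a a≢𝟘 = ham≡1⇒DiffAt (Equivalence.to (φ-edges x (x +w unit k a) (φ-moves x k a a≢𝟘))
    (x , x +w unit k a , refl , refl , DiffAt⇒ham≡1 (DiffAt-unit x k a a≢𝟘)))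

  lift-edge : ∀ x y → ham (φ x) (φ y) ≡ 1 → Σ (Fin n) λ k → Σ (Fin q) λ a → (a ≢ 𝟘) × (φ (x +w unit k a) ≡ φ y)
  lift-edge x y h with Equivalence.from (φ-edges x y (ham≡1⇒≢ h)) h
  ... | x′ , y′ , φx′≡φx , φy′≡φy , x′y′-edge with ham≡1⇒DiffAt x′y′-edge
  ...   | k , x′y′-diff with DiffAt⇒unit x′y′-diff
  ...     | a , a≢𝟘 , y′≡ = k , a , a≢𝟘 ,
    trans (φ-translate (unit k a) (sym φx′≡φx)) (trans (cong φ (sym y′≡)) φy′≡φy)

  ⊖-nonzero : ∀ {a} → a ≢ 𝟘 → (⊖ a) ≢ 𝟘
  ⊖-nonzero {a} a≢𝟘 ⊖a≡𝟘 = a≢𝟘 (⁻¹-injective (trans ⊖a≡𝟘 (sym ε⁻¹≈ε)))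

  e₁ : Fin q
  e₁ = proj₁ (other-letter q≥2 𝟘)

  e₁≢𝟘 : e₁ ≢ 𝟘
  e₁≢𝟘 = proj₂ (other-letter q≥2 𝟘)

  abstract
    d : Fin n → Fin m
    d k = proj₁ (φ-edge 0w k e₁ e₁≢𝟘)

    d-at-origin : ∀ k → DiffAt origin (φ (0w +w unit k e₁)) (d k)
    d-at-origin k = proj₂ (φ-edge 0w k e₁ e₁≢𝟘)

  DirectionInvariant : W → Set
  DirectionInvariant w = ∀ k a → a ≢ 𝟘 → DiffAt (φ w) (φ (w +w unit k a)) (d k)

  -- At the origin: the moves by e₁·e_k, a·e_k and their difference form a triangle.
  invariant-origin : DirectionInvariant 0w
  invariant-origin k a a≢𝟘 with a ≟ e₁
  ... | yes refl = d-at-origin k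
  ... | no a≢e₁ with φ-edge (0w +w unit k e₁) k (a ⊕ (⊖ e₁)) (λ e → a≢e₁ (x∙y⁻¹≈ε⇒x≈y a e₁ e))
                   | φ-edge 0w k a a≢𝟘
  ...   | r , e₁-to-a | r′ , 0-to-a = subst (DiffAt origin (φ (0w +w unit k a))) (sym (triangle (d-at-origin k) 0-to-a e₁-to-a′)) 0-to-a
    where
    e₁-to-a′ : DiffAt (φ (0w +w unit k e₁)) (φ (0w +w unit k a)) r
    e₁-to-a′ = subst (λ v → DiffAt (φ (0w +w unit k e₁)) (φ v) r)
                     (trans (+w-unit-unit 0w k e₁ _) (cong (λ c → 0w +w unit k c) (add-difference e₁ a))) e₁-to-a

  -- Triangles, lines and rectangles of H(m,q') decide the degenerate cases.
  square-edge : ∀ w j b k a → b ≢ 𝟘 → a ≢ 𝟘 → DirectionInvariant w → ∀ γ →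
                DiffAt (φ (w +w unit j b)) (φ ((w +w unit j b) +w unit k a)) γ → γ ≡ d k
  square-edge w j b k a b≢𝟘 a≢𝟘 inv γ d₁₃ =
    by-cases (≡-dec _≟_ (φ w₁) (φ w₂)) (d j ≟ d k) (≡-dec _≟_ (φ w₃) (φ w))
    where
    w₁ w₂ w₃ : W
    w₁ = w +w unit j b
    w₂ = w +w unit k a
    w₃ = w₁ +w unit k a
    d₀₁ : DiffAt (φ w) (φ w₁) (d j)
    d₀₁ = inv j b b≢𝟘
    d₀₂ : DiffAt (φ w) (φ w₂) (d k)
    d₀₂ = inv k a a≢𝟘
    δ : Fin m
    δ = proj₁ (φ-edge w₂ j b b≢𝟘)
    d₂₃ : DiffAt (φ w₂) (φ w₃) δ
    d₂₃ = subst (λ v → DiffAt (φ w₂) (φ v) δ) (trans (+w-assoc w _ _) (trans (cong (w +w_) (+w-comm _ _)) (sym (+w-assoc w _ _))))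
                (proj₂ (φ-edge w₂ j b b≢𝟘))

    -- w₁ and w₂ in one coset: w₃ is w + 2a·e_k up to C.
    coincident : φ w₁ ≡ φ w₂ → γ ≡ d k
    coincident φw₁≡φw₂ with (a ⊕ a) ≟ 𝟘
    ... | yes 2a≡𝟘 = DiffAt-unique d₁₃′ (subst (λ v → DiffAt v (φ w) (d k)) (sym φw₁≡φw₂) (DiffAt-sym d₀₂))
      where
      d₁₃′ : DiffAt (φ w₁) (φ w) γ
      d₁₃′ = subst (λ v → DiffAt (φ w₁) v γ) (trans (φ-translate (unit k a) φw₁≡φw₂)
               (cong φ (trans (+w-unit-unit w k a a) (trans (cong (λ c → w +w unit k c) 2a≡𝟘) (+w-unit-zero w k))))) d₁₃
    ... | no 2a≢𝟘 = triangle′ d₀₂ (inv k (a ⊕ a) 2a≢𝟘) d₂₃′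
      where
      d₂₃′ : DiffAt (φ w₂) (φ (w +w unit k (a ⊕ a))) γ
      d₂₃′ = subst₂ (λ u v → DiffAt u v γ) φw₁≡φw₂
               (trans (φ-translate (unit k a) φw₁≡φw₂) (cong φ (+w-unit-unit w k a a))) d₁₃

    -- w₃ in the coset of w: then w₁ lies in the coset of w - a·e_k.
    closing : φ w₃ ≡ φ w → DiffAt (φ w) (φ w₁) (d k)
    closing φw₃≡φw = subst (λ v → DiffAt (φ w) v (d k)) (sym φw₁≡) (inv k (⊖ a) (⊖-nonzero a≢𝟘))
      where
      φw₁≡ : φ w₁ ≡ φ (w +w unit k (⊖ a))
      φw₁≡ = trans (cong φ (sym (trans (+w-unit-unit w₁ k a (⊖ a)) (trans (cong (λ c → w₁ +w unit k c) (inverseʳ a)) (+w-unit-zero w₁ k)))))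
                   (φ-translate (unit k (⊖ a)) φw₃≡φw)

    by-cases : Dec (φ w₁ ≡ φ w₂) → Dec (d j ≡ d k) → Dec (φ w₃ ≡ φ w) → γ ≡ d k
    by-cases (yes φw₁≡φw₂) _ _ = coincident φw₁≡φw₂
    by-cases (no φw₁≢φw₂) (yes dj≡dk) _ =
      trans (line d₀₁ (subst (DiffAt (φ w) (φ w₂)) (sym dj≡dk) d₀₂) φw₁≢φw₂ d₁₃ d₂₃) dj≡dk
    by-cases (no _) (no dj≢dk) (yes φw₃≡φw) = ⊥-elim (dj≢dk (DiffAt-unique d₀₁ (closing φw₃≡φw)))
    by-cases (no _) (no dj≢dk) (no φw₃≢φw) = rectangle d₀₁ d₀₂ dj≢dk d₁₃ d₂₃ φw₃≢φw

  invariant-step : ∀ w j b → DirectionInvariant w → DirectionInvariant (w +w unit j b)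
  invariant-step w j b inv k a a≢𝟘 with b ≟ 𝟘
  ... | yes refl = subst DirectionInvariant (sym (+w-unit-zero w j)) inv k a a≢𝟘
  ... | no b≢𝟘 with φ-edge (w +w unit j b) k a a≢𝟘
  ...   | γ , d₁₃ = subst (DiffAt (φ (w +w unit j b)) (φ ((w +w unit j b) +w unit k a))) (square-edge w j b k a b≢𝟘 a≢𝟘 inv γ d₁₃) d₁₃

  direction : ∀ w k a → a ≢ 𝟘 → DiffAt (φ w) (φ (w +w unit k a)) (d k)
  direction w = support-induction DirectionInvariant (λ _ → ⊤) (λ _ → yes tt) invariant-origin
                                  (λ w j b _ → invariant-step w j b) w (λ j ¬⊤ → ⊥-elim (¬⊤ tt))

  direction-update : ∀ w k c → c ≢ lookup w k → DiffAt (φ w) (φ (w [ k ]≔ c)) (d k)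
  direction-update w k c c≢ = subst (λ v → DiffAt (φ w) (φ v) (d k)) (sym (update-as-translate w k c))
                                    (direction w k _ (λ e → c≢ (x∙y⁻¹≈ε⇒x≈y _ _ e)))

  φ-local : ∀ i (u w : W) → (∀ k → d k ≡ i → lookup u k ≡ lookup w k) → lookup (φ u) i ≡ lookup (φ w) i
  φ-local i u w agree = begin
    lookup (φ u) i               ≡⟨ cong (λ v → lookup (φ v) i) (sym (+w-difference w u)) ⟩
    lookup (φ (w +w (u -w w))) i ≡⟨ support-induction R (λ j → d j ≢ i) (λ j → ¬? (d j ≟ i)) R-0 R-step (u -w w) outside ⟩
    lookup (φ w) i               ∎
    where
    open ≡-Reasoning
    R : W → Set
    R v = lookup (φ (w +w v)) i ≡ lookup (φ w) i
    R-0 : R 0w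
    R-0 = cong (λ v → lookup (φ v) i) (trans (+w-comm w 0w) (+w-identityˡ w))
    R-step : ∀ v j b → d j ≢ i → R v → R (v +w unit j b)
    R-step v j b dj≢i r with b ≟ 𝟘
    ... | yes refl = subst R (sym (+w-unit-zero v j)) r
    ... | no b≢𝟘 = trans (cong (λ x → lookup (φ x) i) (sym (+w-assoc w v (unit j b))))
                         (trans (sym (agrees (direction (w +w v) j b b≢𝟘) i (λ e → dj≢i (sym e)))) r)
    outside : ∀ j → ¬ (d j ≢ i) → lookup (u -w w) j ≡ 𝟘
    outside j ¬dj≢i with d j ≟ i
    ... | yes dj≡i = trans (lookup--w u w j) (trans (cong (_⊕ (⊖ lookup w j)) (agree j dj≡i)) (inverseʳ _))
    ... | no dj≢i = ⊥-elim (¬dj≢i dj≢i)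

  φ-block : ∀ i (u : W) → (∀ k → d k ≢ i → lookup u k ≡ 𝟘) → ∀ j → j ≢ i → lookup (φ u) j ≡ lookup origin j
  φ-block i u supported = support-induction R (λ j → d j ≡ i) (λ j → d j ≟ i) (λ _ _ → refl) R-step u supported
    where
    R : W → Set
    R u = ∀ j → j ≢ i → lookup (φ u) j ≡ lookup origin j
    R-step : ∀ u k b → d k ≡ i → R u → R (u +w unit k b)
    R-step u k b dk≡i r j j≢i with b ≟ 𝟘
    ... | yes refl = subst R (sym (+w-unit-zero u k)) r j j≢i
    ... | no b≢𝟘 = trans (sym (agrees (direction u k b b≢𝟘) j (λ e → j≢i (trans e dk≡i)))) (r j j≢i)

  adjacent⇒distC≡1 : ∀ x → ham (φ x) origin ≡ 1 → distC C x ≡ 1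
  adjacent⇒distC≡1 x h with lift-edge x 0w h
  ... | k , a , a≢𝟘 , φ≡origin =
    ≤1∧≢0⇒≡1 (adjacent⇒distC≤1 C x _ (origin⇒codeword φ≡origin) (DiffAt⇒ham≡1 (DiffAt-unit x k a a≢𝟘)))
             (λ d≡0 → ham≡1⇒≢ h (codeword⇒origin (distC≡0⇒codeword C x d≡0)))

  distC≡1⇒adjacent : ∀ x → distC C x ≡ 1 → ham (φ x) origin ≡ 1
  distC≡1⇒adjacent x h with distC-attained C x 0w 0∈C
  ... | z , z∈C , d≡ham with ham≡1⇒DiffAt {x = x} {y = z} (trans (sym d≡ham) h)
  ...   | k , x-z with DiffAt⇒unit x-z
  ...     | a , a≢𝟘 , z≡ = DiffAt⇒ham≡1 (subst (λ v → DiffAt (φ x) v (d k))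
                                        (trans (cong φ (sym z≡)) (codeword⇒origin z∈C)) (direction x k a a≢𝟘))

  realise : 2 ≤ q' → ∀ i → Σ W λ x → DiffAt origin (φ x) i
  realise q'≥2 i with φ-onto (origin [ i ]≔ proj₁ (other-letter q'≥2 (lookup origin i)))
  ... | x , φx≡ = x , subst (λ v → DiffAt origin v i) (sym φx≡)
                            (DiffAt-update origin i _ (proj₂ (other-letter q'≥2 (lookup origin i))))

  blockSize : Fin m → ℕ
  blockSize i = sumFin n (λ k → eqInd (d k) i)

  close-neighbour : ∀ x i → DiffAt origin (φ x) i → ∀ k a → a ≢ lookup x k →
    indicator (distC C (x [ k ]≔ a) ≡ᵇ 0) + indicator (distC C (x [ k ]≔ a) ≡ᵇ 1) ≡ eqInd (d k) i
  close-neighbour x i x-adj k a a≢ with d k ≟ i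
  ... | yes dk≡i = exactly-one (distC C y) within-1
    where
    y = x [ k ]≔ a
    agree : ∀ j → j ≢ i → lookup (φ y) j ≡ lookup origin j
    agree j j≢i = trans (sym (agrees (direction-update x k a a≢) j (λ e → j≢i (trans e dk≡i)))) (sym (agrees x-adj j j≢i))
    within-1 : distC C y ≤ 1
    within-1 with agree-off⇒DiffAt (φ y) origin i agree
    ... | inj₁ φy≡origin = ℕP.≤-trans (ℕP.≤-reflexive (codeword⇒distC≡0 C y (origin⇒codeword φy≡origin))) z≤n
    ... | inj₂ adj = ℕP.≤-reflexive (adjacent⇒distC≡1 y (DiffAt⇒ham≡1 (DiffAt-sym adj)))
    exactly-one : ∀ t → t ≤ 1 → indicator (t ≡ᵇ 0) + indicator (t ≡ᵇ 1) ≡ 1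
    exactly-one zero _ = refl
    exactly-one (suc zero) _ = refl
    exactly-one (suc (suc _)) (s≤s ())
  ... | no dk≢i = none (distC C y) ≢0 ≢1
    where
    y = x [ k ]≔ a
    y-edge = direction-update x k a a≢
    differs-at-i : lookup (φ y) i ≢ lookup origin i
    differs-at-i e = differs x-adj (sym (trans (agrees y-edge i (λ e′ → dk≢i (sym e′))) e))
    ≢0 : distC C y ≢ 0
    ≢0 d≡0 = differs-at-i (cong (λ v → lookup v i) (codeword⇒origin (distC≡0⇒codeword C y d≡0)))
    ≢1 : distC C y ≢ 1
    ≢1 d≡1 with ham≡1⇒DiffAt {x = φ y} {y = origin} (distC≡1⇒adjacent y d≡1)
    ... | r , y-adj = dk≢i (trans (DiffAt-only y-adj differs-at-dk) (sym (DiffAt-only y-adj differs-at-i)))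
      where
      differs-at-dk : lookup (φ y) (d k) ≢ lookup origin (d k)
      differs-at-dk e = differs y-edge (trans (sym (agrees x-adj (d k) dk≢i)) (sym e))
    none : ∀ t → t ≢ 0 → t ≢ 1 → indicator (t ≡ᵇ 0) + indicator (t ≡ᵇ 1) ≡ 0
    none zero t≢0 _ = ⊥-elim (t≢0 refl)
    none (suc zero) _ t≢1 = ⊥-elim (t≢1 refl)
    none (suc (suc t)) _ _ = refl

  close-neighbours : ∀ x i → DiffAt origin (φ x) i → nbrCount C x 0 + nbrCount C x 1 ≡ blockSize i * (q ∸ 1)
  close-neighbours x i x-adj = begin
    nbrCount C x 0 + nbrCount C x 1
      ≡⟨ sym (sumOver-+ (L.allFin n) _ _) ⟩
    sumFin n (λ k → sumFin q (λ a → close k a 0) + sumFin q (λ a → close k a 1))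
      ≡⟨ sumFin-cong n (λ k → sym (sumOver-+ (L.allFin q) _ _)) ⟩
    sumFin n (λ k → sumFin q (λ a → close k a 0 + close k a 1))
      ≡⟨ sumFin-cong n (λ k → sumFin-cong q (λ a → per-letter k a)) ⟩
    sumFin n (λ k → sumFin q (λ a → neqInd a (lookup x k) * eqInd (d k) i))
      ≡⟨ sumFin-cong n (λ k → trans (sumOver-*ʳ (L.allFin q) _ (eqInd (d k) i)) (cong (_* eqInd (d k) i) (sumFin-neqInd q (lookup x k)))) ⟩
    sumFin n (λ k → (q ∸ 1) * eqInd (d k) i)
      ≡⟨ sumFin-cong n (λ k → ℕP.*-comm (q ∸ 1) _) ⟩
    sumFin n (λ k → eqInd (d k) i * (q ∸ 1))
      ≡⟨ sumOver-*ʳ (L.allFin n) (λ k → eqInd (d k) i) (q ∸ 1) ⟩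
    blockSize i * (q ∸ 1) ∎
    where
    open ≡-Reasoning
    close : Fin n → Fin q → ℕ → ℕ
    close k a j = indicator (not (does (a ≟ lookup x k)) ∧ (distC C (x [ k ]≔ a) ≡ᵇ j))
    per-letter : ∀ k a → close k a 0 + close k a 1 ≡ neqInd a (lookup x k) * eqInd (d k) i
    per-letter k a with a ≟ lookup x k
    ... | yes _ = refl
    ... | no a≢ = trans (close-neighbour x i x-adj k a a≢) (sym (ℕP.+-identityʳ _))

common-value : ∀ {m} (f : Fin m → ℕ) → (∀ i j → f i ≡ f j) → ∃ λ ℓ → ∀ i → f i ≡ ℓ
common-value {zero} f _ = 0 , λ ()
common-value {suc m} f same = f zero , λ i → same i zero

*-cancel-pred : ∀ {a b} q → 2 ≤ q → a * (q ∸ 1) ≡ b * (q ∸ 1) → a ≡ b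
*-cancel-pred {a} {b} (suc (suc q)) (s≤s (s≤s _)) = ℕP.*-cancelʳ-≡ a b (suc q)
*-cancel-pred (suc zero) (s≤s ())

module Decomposition {q : ℕ} (G : AbelianGroupOn q) (q≥2 : 2 ≤ q) {n : ℕ} (C : Code n q)
  (additive : WordGroup.Additive G C) (cr : CompletelyRegular C) (δ≥2 : MinDistAtLeast2 C)
  {m q' : ℕ} (q'≥2 : 2 ≤ q') (iso : WordGroup.QuotientIsoHamming G C m q') where

  open AbelianGroupOn G
  open Words G
  open Geometry G q≥2 C (proj₁ additive) δ≥2 iso

  -- Complete regularity compares neighbours of the origin in directions i, i′.
  blockSize-constant : ∀ i i′ → blockSize i ≡ blockSize i′
  blockSize-constant i i′ with realise q'≥2 i | realise q'≥2 i′
  ... | x , x-adj | x′ , x′-adj = *-cancel-pred q q≥2 (begin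
    blockSize i * (q ∸ 1)               ≡⟨ sym (close-neighbours x i x-adj) ⟩
    nbrCount C x 0 + nbrCount C x 1     ≡⟨ cong₂ _+_ (equitable 0) (equitable 1) ⟩
    nbrCount C x′ 0 + nbrCount C x′ 1   ≡⟨ close-neighbours x′ i′ x′-adj ⟩
    blockSize i′ * (q ∸ 1)              ∎)
    where
    open ≡-Reasoning
    at-1 : ∀ {y i} → DiffAt origin (φ y) i → distC C y ≡ 1
    at-1 adj = adjacent⇒distC≡1 _ (DiffAt⇒ham≡1 (DiffAt-sym adj))
    equitable : ∀ j → nbrCount C x j ≡ nbrCount C x′ j
    equitable = proj₂ cr x x′ (trans (at-1 x-adj) (sym (at-1 x′-adj)))

  ℓ : ℕ
  ℓ = proj₁ (common-value blockSize blockSize-constant)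

  open EqualFibres n m ℓ d (proj₂ (common-value blockSize blockSize-constant)) public

  embed : Fin m → Word ℓ q → W
  embed i y = tabulate (λ k → if does (d k ≟ i) then lookup y (rank k) else 𝟘)

  restrict : Fin m → W → Word ℓ q
  restrict i x = tabulate (λ j → lookup x (position (i , j)))

  embed-off : ∀ i y k → d k ≢ i → lookup (embed i y) k ≡ 𝟘
  embed-off i y k dk≢i = trans (lookup∘tabulate _ k) (if-no (d k ≟ i) dk≢i)

  embed-on : ∀ i y k → d k ≡ i → lookup (embed i y) k ≡ lookup y (rank k)
  embed-on i y k dk≡i = trans (lookup∘tabulate _ k) (if-yes (d k ≟ i) dk≡i)

  embed-position : ∀ i y j → lookup (embed i y) (position (i , j)) ≡ lookup y j
  embed-position i y j = trans (embed-on i y _ (d-position i j)) (cong (lookup y) (rank-position i j))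

  embed-restrict : ∀ i x k → d k ≡ i → lookup (embed i (restrict i x)) k ≡ lookup x k
  embed-restrict i x k dk≡i = trans (embed-on i (restrict i x) k dk≡i)
    (trans (lookup∘tabulate (λ j → lookup x (position (i , j))) (rank k)) (cong (lookup x) (position-rank′ dk≡i)))

  embed-update : ∀ i y j c → embed i (y [ j ]≔ c) ≡ embed i y [ position (i , j) ]≔ c
  embed-update i y j c = vext (λ k → pointwise k (k ≟ position (i , j)) (d k ≟ i))
    where
    pointwise : ∀ k → Dec (k ≡ position (i , j)) → Dec (d k ≡ i) →
                lookup (embed i (y [ j ]≔ c)) k ≡ lookup (embed i y [ position (i , j) ]≔ c) k
    pointwise k (yes refl) _ = trans (embed-position i (y [ j ]≔ c) j)
      (trans (lookup∘update j y c) (sym (lookup∘update (position (i , j)) (embed i y) c)))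
    pointwise k (no k≢) (yes dk≡i) = trans (embed-on i (y [ j ]≔ c) k dk≡i)
      (trans (lookup∘update′ rank≢ y c) (trans (sym (embed-on i y k dk≡i)) (sym (lookup∘update′ k≢ (embed i y) c))))
      where
      rank≢ : rank k ≢ j
      rank≢ e = k≢ (trans (sym (position-rank′ dk≡i)) (cong (λ j′ → position (i , j′)) e))
    pointwise k (no k≢) (no dk≢i) = trans (embed-off i (y [ j ]≔ c) k dk≢i)
      (trans (sym (embed-off i y k dk≢i)) (sym (lookup∘update′ k≢ (embed i y) c)))

  embed-zero : ∀ i → embed i 0w ≡ 0w
  embed-zero i = vext (λ k → pointwise k (d k ≟ i))
    where
    pointwise : ∀ k → Dec (d k ≡ i) → lookup (embed i 0w) k ≡ lookup (0w {n}) k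
    pointwise k (yes dk≡i) = trans (embed-on i 0w k dk≡i) (trans (lookup-replicate (rank k) 𝟘) (sym (lookup-replicate k 𝟘)))
    pointwise k (no dk≢i) = trans (embed-off i 0w k dk≢i) (sym (lookup-replicate k 𝟘))

  component : Fin m → Code ℓ q
  component i y = C (embed i y)

  component-nonempty : ∀ i → ∃ λ y → y ∈C component i
  component-nonempty i = 0w , subst (_∈C C) (sym (embed-zero i)) (proj₁ additive)

  product : ∀ x → (x ∈C C) ⇔ (∀ i → restrict i x ∈C component i)
  product x = mk⇔ to from
    where
    to : x ∈C C → ∀ i → restrict i x ∈C component i
    to x∈C i = origin⇒codeword (vext (λ j → pointwise j (j ≟ i)))
      where
      pointwise : ∀ j → Dec (j ≡ i) → lookup (φ (embed i (restrict i x))) j ≡ lookup origin j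
      pointwise j (yes refl) = trans (φ-local i _ x (embed-restrict i x)) (cong (λ v → lookup v i) (codeword⇒origin x∈C))
      pointwise j (no j≢i) = φ-block i _ (embed-off i (restrict i x)) j j≢i
    from : (∀ i → restrict i x ∈C component i) → x ∈C C
    from blocks∈C = origin⇒codeword (vext λ i →
      trans (sym (φ-local i _ x (embed-restrict i x))) (cong (λ v → lookup v i) (codeword⇒origin (blocks∈C i))))

  non-component⇒adjacent : ∀ i y → component i y ≡ false → DiffAt origin (φ (embed i y)) i
  non-component⇒adjacent i y y∉ =
    Sum.[ (λ φ≡origin → ⊥-elim (true≢false (trans (sym (origin⇒codeword φ≡origin)) y∉))) , (λ adj → adj) ]′
      (agree-off⇒DiffAt (φ (embed i y)) origin i (φ-block i _ (embed-off i y)))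

  -- C⁽ⁱ⁾ has covering radius ≤ 1: lifting the edge from φ(embed i y) back to
  -- the origin moves along a coordinate of block i, i.e. changes one letter of y.
  component-at-1 : ∀ i y → component i y ≡ false → distC (component i) y ≡ 1
  component-at-1 i y y∉ = from-lift (lift-edge u 0w (DiffAt⇒ham≡1 (DiffAt-sym adj)))
    where
    u = embed i y
    adj = non-component⇒adjacent i y y∉
    from-lift : (Σ (Fin n) λ k → Σ (Fin q) λ a → (a ≢ 𝟘) × (φ (u +w unit k a) ≡ origin)) → distC (component i) y ≡ 1
    from-lift (k , a , a≢𝟘 , φ≡origin) =
      ≤1∧≢0⇒≡1 (adjacent⇒distC≤1 (component i) y _ neighbour∈ (DiffAt⇒ham≡1 (DiffAt-update y (rank k) c c≢)))
               (λ d≡0 → true≢false (trans (sym (distC≡0⇒codeword (component i) y d≡0)) y∉))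
      where
      c = lookup y (rank k) ⊕ a
      c≢ : c ≢ lookup y (rank k)
      c≢ e = a≢𝟘 (identityʳ-unique _ _ e)
      dk≡i : d k ≡ i
      dk≡i = DiffAt-unique (subst (λ v → DiffAt (φ u) v (d k)) φ≡origin (direction u k a a≢𝟘)) (DiffAt-sym adj)
      neighbour∈ : component i (y [ rank k ]≔ c) ≡ true
      neighbour∈ = subst (_∈C C) (sym (begin
        embed i (y [ rank k ]≔ c)                       ≡⟨ embed-update i y (rank k) c ⟩
        u [ position (i , rank k) ]≔ c                  ≡⟨ cong (u [_]≔ c) (position-rank′ dk≡i) ⟩
        u [ k ]≔ (lookup y (rank k) ⊕ a)                ≡⟨ cong (λ b → u [ k ]≔ (b ⊕ a)) (sym (embed-on i y k dk≡i)) ⟩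
        u [ k ]≔ (lookup u k ⊕ a)                       ≡⟨ sym (+w-unit u k a) ⟩
        u +w unit k a                                   ∎)) (origin⇒codeword φ≡origin)
        where open ≡-Reasoning

  -- No two codewords of C⁽ⁱ⁾ are adjacent, as δ(C) ≥ 2.
  component-isolated : ∀ i x k a → component i x ≡ true → a ≢ lookup x k → component i (x [ k ]≔ a) ≡ false
  component-isolated i x k a x∈ a≢ = ¬true⇒false λ x′∈ →
    DiffAt⇒≢ edge (trans (codeword⇒origin x∈) (sym (subst (λ v → φ v ≡ origin) (embed-update i x k a) (codeword⇒origin x′∈))))
    where
    edge : DiffAt (φ (embed i x)) (φ (embed i x [ position (i , k) ]≔ a)) (d (position (i , k)))
    edge = direction-update (embed i x) (position (i , k)) a (λ e → a≢ (trans e (embed-position i x k)))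

  -- A non-codeword of C⁽ⁱ⁾ has as many codeword neighbours as its embedding
  -- has neighbours in C: all of those lie along block i.
  component-neighbours : ∀ i x → component i x ≡ false →
                         countNeighbours x (component i) ≡ nbrCount C (embed i x) 0
  component-neighbours i x x∉ = sym (trans (sum-over-fibre i g off-block) (sumFin-cong ℓ on-block))
    where
    u = embed i x
    adj = non-component⇒adjacent i x x∉
    g : Fin n → ℕ
    g k = sumFin q (λ a → indicator (not (does (a ≟ lookup u k)) ∧ (distC C (u [ k ]≔ a) ≡ᵇ 0)))
    off-block : ∀ k → d k ≢ i → g k ≡ 0
    off-block k dk≢i = trans (letter-count-cong (lookup u k) outside-C) (letter-count-const (lookup u k) false)
      where
      outside-C : ∀ a → a ≢ lookup u k → (distC C (u [ k ]≔ a) ≡ᵇ 0) ≡ false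
      outside-C a a≢ = trans (distC≡ᵇ0 C _) (¬true⇒false λ w∈C → differs adj (sym (trans
        (agrees (direction-update u k a a≢) i (λ e → dk≢i (sym e))) (cong (λ v → lookup v i) (codeword⇒origin w∈C)))))
    on-block : ∀ j → g (position (i , j)) ≡ sumFin q (λ a → indicator (not (does (a ≟ lookup x j)) ∧ component i (x [ j ]≔ a)))
    on-block j = sumFin-cong q λ a → cong₂ (λ b t → indicator (not (does (a ≟ b)) ∧ t))
      (embed-position i x j) (trans (distC≡ᵇ0 C _) (cong C (sym (embed-update i x j a))))

  -- C⁽ⁱ⁾ is completely regular: non-codewords of C⁽ⁱ⁾ correspond to words at
  -- distance 1 from C, whose neighbour counts agree by complete regularity of C.
  component-completelyRegular : ∀ i → CompletelyRegular (component i)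
  component-completelyRegular i =
    Radius1.completelyRegular (component i) (component-nonempty i) (component-at-1 i) (component-isolated i) same-count
    where
    at-1 : ∀ y → component i y ≡ false → distC C (embed i y) ≡ 1
    at-1 y y∉ = adjacent⇒distC≡1 _ (DiffAt⇒ham≡1 (DiffAt-sym (non-component⇒adjacent i y y∉)))
    same-count : ∀ x y → component i x ≡ false → component i y ≡ false →
                 countNeighbours x (component i) ≡ countNeighbours y (component i)
    same-count x y x∉ y∉ = begin
      countNeighbours x (component i)     ≡⟨ component-neighbours i x x∉ ⟩
      nbrCount C (embed i x) 0            ≡⟨ proj₂ cr (embed i x) (embed i y) (trans (at-1 x x∉) (sym (at-1 y y∉))) 0 ⟩
      nbrCount C (embed i y) 0            ≡⟨ sym (component-neighbours i y y∉) ⟩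
      countNeighbours y (component i)     ∎
      where open ≡-Reasoning

  -- C⁽ⁱ⁾ ≠ Q^ℓ: block i of a word realising direction i is not in C⁽ⁱ⁾.
  component-coveringRadius : ∀ i → CoveringRadius (component i) 1
  component-coveringRadius i =
    Radius1.coveringRadius-1 (component i) (component-nonempty i) (component-at-1 i) (restrict i x , y∉)
    where
    x = proj₁ (realise q'≥2 i)
    y∉ : component i (restrict i x) ≡ false
    y∉ = ¬true⇒false λ y∈ → differs (proj₂ (realise q'≥2 i))
           (sym (trans (sym (φ-local i _ x (embed-restrict i x))) (cong (λ v → lookup v i) (codeword⇒origin y∈))))

theorem3p11 : (q : ℕ) → 2 ≤ q → (G : AbelianGroupOn q) → (n : ℕ) → (C : Code n q) →
    WordGroup.Additive G C → CompletelyRegular C → MinDistAtLeast2 C →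
    (m q' : ℕ) → 2 ≤ q' → WordGroup.QuotientIsoHamming G C m q' →
    (m ∣ n) ×
    (Σ ℕ λ ℓ → (n ≡ m * ℓ) ×
      (Σ ((Fin m × Fin ℓ) ↔ Fin n) λ π →
        Σ (Fin m → Code ℓ q) λ Cs →
          (∀ i → CompletelyRegular (Cs i) × CoveringRadius (Cs i) 1) ×
          (∀ (x : Word n q) → (x ∈C C) ⇔
             (∀ i → tabulate (λ j → lookup x (Inverse.to π (i , j))) ∈C Cs i))))
theorem3p11 q q≥2 G n C additive cr δ≥2 m q' q'≥2 iso =
  subst (m ∣_) (sym n≡m*ℓ) (m∣m*n ℓ) , ℓ , n≡m*ℓ , π , component ,
  (λ i → component-completelyRegular i , component-coveringRadius i) , product
  where open Decomposition G q≥2 C additive cr δ≥2 q'≥2 iso
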